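{- Let $m\geq 3$ be a natural number with $m\not\equiv 0\pmod 4$. Let $V$ be the quadratic space over $\mathbb{Q}$ with orthogonal basis $e_1,e_2,e_3$, where $Q(e_i)=(m-2)^2$ if $m$ is even and $Q(e_i)=4(m-2)^2$ if $m$ is odd; let $L=\mathbb{Z}e_1+\mathbb{Z}e_2+\mathbb{Z}e_3$ and $\nu=\frac{m-4}{2(m-2)}(e_1+e_2+e_3)$. For $n\in\mathbb{N}_0$ set \[ \ell_n=\begin{cases}3\left(\frac{m-4}{2}\right)^2+2(m-2)n & m\text{ even},\\ 3(m-4)^2+8(m-2)n & m\text{ odd}.\end{cases} \] Then for every $n$ and every prime $p$, $\ell_n$ is represented by the coset $L_p+\nu$, i.e., there exists $x\in L_p+\nu$ with $Q(x)=\ell_n$.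
   Context: $L_p=L\otimes_{\mathbb{Z}}\mathbb{Z}_p$, a $\mathbb{Z}_p$-lattice in $V_p=V\otimes\mathbb{Q}_p$ with the $\mathbb{Q}_p$-linear extension of $Q$. -}

module Defs where

open import Data.Nat as ℕ using (ℕ; suc; _^_)
open import Data.Nat.DivMod using (_/_; _%_)
open import Data.Integer using (ℤ; +_; _+_; _-_; _*_)
open import Data.Integer.Divisibility using (_∣_)
open import Data.Fin using (Fin; zero; suc)
open import Data.Bool using (Bool; if_then_else_)
open import Data.Product using (Σ)

isEven : ℕ → Bool
isEven m = (m % 2) ℕ.≡ᵇ 0

-- p-adic integers as the inverse limit of ℤ/p^k ℤ:
-- a compatible sequence of integers, the k-th entry read modulo p^k.
-- Ring operations are componentwise; equality x = c means p^k ∣ (x_k - c) for all k.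
record ℤₚ (p : ℕ) : Set where
  field
    seq    : ℕ → ℤ
    compat : ∀ k → (+ (p ^ k)) ∣ (seq (suc k) - seq k)
open ℤₚ public

sq : ℤ → ℤ
sq x = x * x

-- (m-4)/2 as an integer (used only for even m)
half-m-4 : ℕ → ℤ
half-m-4 m = + (m / 2) - + 2

-- For y = (y₁,y₂,y₃) (coordinates in L_p) and x = y₁e₁+y₂e₂+y₃e₃ + ν,
-- ν = (m-4)/(2(m-2)) (e₁+e₂+e₃), one has Q(x) = Σᵢ c (yᵢ + (m-4)/(2(m-2)))²
-- with c = (m-2)² (m even) resp. 4(m-2)² (m odd), i.e. exactly
--   m even : Σᵢ ((m-2) yᵢ + (m-4)/2)²
--   m odd  : Σᵢ (2(m-2) yᵢ + (m-4))²
-- which is a polynomial with integer coefficients in the yᵢ.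
Qterm : ℕ → ℤ → ℤ
Qterm m y = if isEven m
  then sq ((+ m - + 2) * y + half-m-4 m)
  else sq ((+ 2 * (+ m - + 2)) * y + (+ m - + 4))

Qν : ℕ → (Fin 3 → ℤ) → ℤ
Qν m y = Qterm m (y zero) + Qterm m (y (suc zero)) + Qterm m (y (suc (suc zero)))

ℓ : ℕ → ℕ → ℤ
ℓ m n = if isEven m
  then + 3 * sq (half-m-4 m) + + 2 * (+ m - + 2) * + n
  else + 3 * sq (+ m - + 4) + + 8 * (+ m - + 2) * + n

-- the integer t is represented by the coset L_p + ν : there is y ∈ L_p = ℤ_p³
-- with Q(y + ν) = t in ℤ_p (evaluated componentwise in the inverse limit).
RepresentedByCoset : (m p : ℕ) → ℤ → Set
RepresentedByCoset m p t =
  Σ (Fin 3 → ℤₚ p) λ y → ∀ k → (+ (p ^ k)) ∣ (Qν m (λ i → seq (y i) k) - t)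

{-# OPTIONS --safe #-}
-- Writing x = y + ν with y ∈ ℤ_p³, the equation Q(x) = ℓₙ becomes 4A·(A Σ yᵢ² + B Σ yᵢ − T) = 0
-- for explicit integers A, B, T (A = (m − 2)/2 or m − 2). By Hensel's lemma in y₁ it suffices to
-- solve A Σ yᵢ² + B Σ yᵢ ≡ T (mod p) with 2Ay₁ + B a unit mod p. If p ∣ A·T the congruence is
-- linear up to a multiple of A·T and has an explicit such root. Otherwise p is odd and p ∤ A,
-- and completing the square reduces it to z₂² + z₃² ≡ c (mod p), which is solvable for every c
-- by the pigeonhole principle.
module Submission where

open import Data.Nat using (ℕ; _≤_)
open import Data.Nat.Divisibility using (_∣_)
open import Data.Nat.Primality using (Prime)
open import Relation.Nullary using (¬_)
open import Defs

open import Relation.Nullary using (yes; no)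

open import Data.Nat as ℕ using (zero; suc; _^_; _<_; _⊔_; NonZero)
import Data.Nat.Properties as ℕ
import Data.Nat.Divisibility as ℕ
open import Data.Nat.Primality using (euclidsLemma; prime⇒nonZero; prime⇒irreducible; ¬prime[1])
open import Data.Nat.Coprimality using (coprime-Bézout; prime⇒coprime)
open import Data.Nat.GCD using (module Bézout)
open import Data.Integer using (ℤ; +_; _+_; _-_; _*_; -_; 0ℤ; ∣_∣)
open import Data.Integer.Properties
  using (pos-*; pos-+; abs-*; *-comm; *-identityˡ; +-identityʳ; neg-distribˡ-*; +-injective; ∣i∣≡0⇒i≡0; i-j≡0⇒i≡j; m-n≡m⊖n; ∣m⊝n∣≤m⊔n; +-inverseʳ)
open import Data.Nat.DivMod using (_/_; m*n/n≡m; m*n%n≡0; [m+kn]%n≡m%n)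
open import Data.Integer.DivMod using (_%ℕ_; _/ℕ_; n%ℕd<d; a≡a%ℕn+[a/ℕn]*n)
open import Data.Integer.Divisibility.Signed
  using (divides; ∣ᵤ⇒∣; ∣⇒∣ᵤ; ∣-refl; ∣-trans; ∣m∣n⇒∣m+n; ∣m∣n⇒∣m-n; ∣m⇒∣-m; ∣n⇒∣m*n; ∣m⇒∣m*n; *-monoʳ-∣; *-monoˡ-∣)
  renaming (_∣_ to _∣ℤ_; _∣?_ to _∣ℤ?_)
open import Data.Integer.Tactic.RingSolver using (solve-∀)
open import Data.Fin using (Fin; zero; suc; toℕ; fromℕ<; splitAt; join)
open import Data.Fin.Properties using (pigeonhole; toℕ-fromℕ<; toℕ-injective; toℕ<n; join-splitAt; <⇒≢)
open import Data.Product using (Σ; ∃; ∃₂; _,_; _×_; proj₁; uncurry)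
open import Data.Bool using (true; false)
open import Data.Bool.Properties using (if-cong)
open import Data.Sum using (_⊎_; inj₁; inj₂; [_,_]′)
open import Data.Empty using (⊥-elim)
open import Function using (_∘_)
open import Relation.Binary.PropositionalEquality

∣ℤ-lincomb : ∀ {d a b x} s t → d ∣ℤ a → d ∣ℤ b → x ≡ s * a + t * b → d ∣ℤ x
∣ℤ-lincomb s t d∣a d∣b refl = ∣m∣n⇒∣m+n (∣n⇒∣m*n s d∣a) (∣n⇒∣m*n t d∣b)

*-pres-∣ℤ : ∀ {a b c d} → a ∣ℤ b → c ∣ℤ d → a * c ∣ℤ b * d
*-pres-∣ℤ {a} {d = d} a∣b c∣d = ∣-trans (*-monoʳ-∣ a c∣d) (*-monoˡ-∣ d a∣b)

difference-of-squares : ∀ x y → x * x - y * y ≡ (x + y) * (x - y)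
difference-of-squares = solve-∀

∣ℤ-x-y⇒∣ℤ-x²-y² : ∀ {d} x y → d ∣ℤ x - y → d ∣ℤ x * x - y * y
∣ℤ-x-y⇒∣ℤ-x²-y² x y d∣x-y = subst (_ ∣ℤ_) (sym (difference-of-squares x y)) (∣n⇒∣m*n (x + y) d∣x-y)

∣ℤ-small⇒≡0 : ∀ {p x} → + p ∣ℤ x → ∣ x ∣ < p → x ≡ 0ℤ
∣ℤ-small⇒≡0 {p} {x} p∣x x<p = ∣i∣≡0⇒i≡0 (small⇒≡0 (∣⇒∣ᵤ p∣x) x<p)
  where
  small⇒≡0 : ∀ {n} → p ∣ n → n < p → n ≡ 0
  small⇒≡0 {zero}  _   _   = refl
  small⇒≡0 {suc n} p∣n n<p = ⊥-elim (ℕ.>⇒∤ n<p p∣n)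

pow-suc : ∀ p n → + (p ^ suc n) ≡ + (p ^ n) * + p
pow-suc p n = trans (pos-* p (p ^ n)) (*-comm (+ p) (+ (p ^ n)))

p∣p^1+n : ∀ p n → + p ∣ℤ + (p ^ suc n)
p∣p^1+n p n = divides (+ (p ^ n)) (pow-suc p n)

p^n∣p^1+n : ∀ p n → + (p ^ n) ∣ℤ + (p ^ suc n)
p^n∣p^1+n p n = divides (+ p) (pos-* p (p ^ n))

∣ℤ-x-%ℕ : ∀ p .{{_ : NonZero p}} x → + p ∣ℤ x - + (x %ℕ p)
∣ℤ-x-%ℕ p x = divides (x /ℕ p) (begin
  x - + (x %ℕ p)                               ≡⟨ cong (_- + (x %ℕ p)) (a≡a%ℕn+[a/ℕn]*n x p) ⟩
  + (x %ℕ p) + x /ℕ p * + p - + (x %ℕ p)       ≡⟨ cancel (+ (x %ℕ p)) (x /ℕ p * + p) ⟩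
  x /ℕ p * + p                                 ∎)
  where
  open ≡-Reasoning
  cancel : ∀ r s → r + s - r ≡ s
  cancel = solve-∀

%ℕ-≡⇒∣ℤ- : ∀ p .{{_ : NonZero p}} x y → x %ℕ p ≡ y %ℕ p → + p ∣ℤ x - y
%ℕ-≡⇒∣ℤ- p x y eq = subst (+ p ∣ℤ_) (cancel x y (+ (y %ℕ p)))
  (∣m∣n⇒∣m-n (subst (λ r → + p ∣ℤ x - + r) eq (∣ℤ-x-%ℕ p x)) (∣ℤ-x-%ℕ p y))
  where
  cancel : ∀ x y r → (x - r) - (y - r) ≡ x - y
  cancel = solve-∀

ℕ-Bézout⇒ℤ : ∀ c x n y m → c ℕ.+ x ℕ.* n ≡ y ℕ.* m → + c + + x * + n ≡ + y * + m
ℕ-Bézout⇒ℤ c x n y m eq = begin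
  + c + + x * + n     ≡⟨ cong (_+_ (+ c)) (sym (pos-* x n)) ⟩
  + c + + (x ℕ.* n)   ≡⟨ sym (pos-+ c (x ℕ.* n)) ⟩
  + (c ℕ.+ x ℕ.* n)   ≡⟨ cong +_ eq ⟩
  + (y ℕ.* m)         ≡⟨ pos-* y m ⟩
  + y * + m           ∎
  where open ≡-Reasoning

Bézout⇒inverse : ∀ {p k} → Bézout.Identity 1 p k → ∃ λ w → + p ∣ℤ w * + k - + 1
Bézout⇒inverse {p} {k} (Bézout.+- a b 1+bk≡ap) =
  - + b , divides (- + a) (trans (negate (+ b) (+ k)) (trans (cong -_ (ℕ-Bézout⇒ℤ 1 b k a p 1+bk≡ap)) (neg-distribˡ-* (+ a) (+ p))))
  where
  negate : ∀ b k → (- b) * k - + 1 ≡ - (+ 1 + b * k)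
  negate = solve-∀
Bézout⇒inverse {p} {k} (Bézout.-+ a b 1+ap≡bk) =
  + b , divides (+ a) (trans (cong (_- + 1) (sym (ℕ-Bézout⇒ℤ 1 a p b k 1+ap≡bk))) (cancel (+ a * + p)))
  where
  cancel : ∀ s → + 1 + s - + 1 ≡ s
  cancel = solve-∀

module _ {p : ℕ} (p-prime : Prime p) where
  private instance
    p≢0 : NonZero p
    p≢0 = prime⇒nonZero p-prime

  prime-∣ℤ-* : ∀ x y → + p ∣ℤ x * y → + p ∣ℤ x ⊎ + p ∣ℤ y
  prime-∣ℤ-* x y p∣xy with euclidsLemma ∣ x ∣ ∣ y ∣ p-prime (subst (p ℕ.∣_) (abs-* x y) (∣⇒∣ᵤ p∣xy))
  ... | inj₁ p∣x = inj₁ (∣ᵤ⇒∣ p∣x)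
  ... | inj₂ p∣y = inj₂ (∣ᵤ⇒∣ p∣y)

  prime-∤ℤ-* : ∀ {x y} → ¬ + p ∣ℤ x → ¬ + p ∣ℤ y → ¬ + p ∣ℤ x * y
  prime-∤ℤ-* {x} {y} p∤x p∤y p∣xy with prime-∣ℤ-* x y p∣xy
  ... | inj₁ p∣x = p∤x p∣x
  ... | inj₂ p∣y = p∤y p∣y

  prime-∣ℤ-*-cancelˡ : ∀ {x y} → ¬ + p ∣ℤ x → + p ∣ℤ x * y → + p ∣ℤ y
  prime-∣ℤ-*-cancelˡ {x} {y} p∤x p∣xy with prime-∣ℤ-* x y p∣xy
  ... | inj₁ p∣x = ⊥-elim (p∤x p∣x)
  ... | inj₂ p∣y = p∣y

  inverse-mod-prime : ∀ x → ¬ + p ∣ℤ x → ∃ λ w → + p ∣ℤ w * x - + 1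
  inverse-mod-prime x p∤x with x %ℕ p | ∣ℤ-x-%ℕ p x | n%ℕd<d x p
  ... | zero  | p∣x-0 | _   = ⊥-elim (p∤x (subst (+ p ∣ℤ_) (+-identityʳ x) p∣x-0))
  ... | suc k | p∣x-k | k<p with Bézout⇒inverse (coprime-Bézout (prime⇒coprime p-prime k<p))
  ... | w , p∣wk-1 = w , ∣ℤ-lincomb w (+ 1) p∣x-k p∣wk-1 (identity w x (+ suc k))
    where
    identity : ∀ w x k → w * x - + 1 ≡ w * (x - k) + + 1 * (w * k - + 1)
    identity = solve-∀

data Parity : ℕ → Set where
  even : ∀ k → Parity (k ℕ.* 2)
  odd  : ∀ k → Parity (suc (k ℕ.* 2))

parity : ∀ n → Parity n
parity zero = even 0
parity (suc n) with parity n
... | even k = odd k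
... | odd k  = even (suc k)

data PrimeCase : ℕ → Set where
  two : PrimeCase 2
  odd : ∀ r → Prime (suc (r ℕ.* 2)) → PrimeCase (suc (r ℕ.* 2))

primeCase : ∀ {p} → Prime p → PrimeCase p
primeCase {p} p-prime with parity p
... | odd r  = odd r p-prime
... | even k with prime⇒irreducible p-prime (ℕ.divides k refl)
...   | inj₁ ()
...   | inj₂ 2≡k*2 = subst PrimeCase 2≡k*2 two

+1+2h : ∀ h → + suc (h ℕ.* 2) ≡ + 1 + + h * + 2
+1+2h h = trans (pos-+ 1 (h ℕ.* 2)) (cong (_+_ (+ 1)) (pos-* h 2))

quadratic₀ : ℤ → ℤ → ℤ → ℤ
quadratic₀ A B y = A * y * y + B * y

quadratic : ℤ → ℤ → ℤ → ℤ → ℤ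
quadratic A B C y = quadratic₀ A B y + C

quadratic′ : ℤ → ℤ → ℤ → ℤ
quadratic′ A B y = + 2 * A * y + B

record SimpleRoot (p : ℕ) (A B C : ℤ) : Set where
  constructor simpleRoot
  field
    root               : ℤ
    inverse            : ℤ
    isRoot             : + p ∣ℤ quadratic A B C root
    inverse-derivative : + p ∣ℤ inverse * quadratic′ A B root - + 1

-- Newton's step with a frozen approximate inverse w of the derivative. With F = f(u),
-- f(u − wF) = −F·(w f′(u) − 1) + A w² F², and both terms gain a factor p.
chord-step : ∀ {p} A B C e u w →
  + (p ^ suc e) ∣ℤ quadratic A B C u → + p ∣ℤ w * quadratic′ A B u - + 1 →
  + (p ^ suc (suc e)) ∣ℤ quadratic A B C (u - w * quadratic A B C u) ×
  + p ∣ℤ w * quadratic′ A B (u - w * quadratic A B C u) - + 1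
chord-step {p} A B C e u w p^1+e∣F p∣δ =
  ∣ℤ-lincomb (- + 1) (A * w * w) (subst (_∣ℤ _) p^1+e*p≡p^2+e (*-pres-∣ℤ p^1+e∣F p∣δ))
                                 (subst (_∣ℤ _) p^1+e*p≡p^2+e (*-pres-∣ℤ p^1+e∣F p∣F))
                                 (taylor A B C u w) ,
  ∣ℤ-lincomb (+ 1) (- (+ 2 * A * w * w)) p∣δ p∣F (taylor′ A B C u w)
  where
  p∣F : + p ∣ℤ quadratic A B C u
  p∣F = ∣-trans (p∣p^1+n p e) p^1+e∣F
  p^1+e*p≡p^2+e : + (p ^ suc e) * + p ≡ + (p ^ suc (suc e))
  p^1+e*p≡p^2+e = sym (pow-suc p (suc e))
  taylor : ∀ A B C u w →
    A * (u - w * (A * u * u + B * u + C)) * (u - w * (A * u * u + B * u + C)) + B * (u - w * (A * u * u + B * u + C)) + C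
    ≡ (- + 1) * ((A * u * u + B * u + C) * (w * (+ 2 * A * u + B) - + 1))
      + (A * w * w) * ((A * u * u + B * u + C) * (A * u * u + B * u + C))
  taylor = solve-∀
  taylor′ : ∀ A B C u w →
    w * (+ 2 * A * (u - w * (A * u * u + B * u + C)) + B) - + 1
    ≡ + 1 * (w * (+ 2 * A * u + B) - + 1) + (- (+ 2 * A * w * w)) * (A * u * u + B * u + C)
  taylor′ = solve-∀

fromℤ : ∀ {p} → ℤ → ℤₚ p
fromℤ {p} c = record { seq = λ _ → c ; compat = λ k → ∣⇒∣ᵤ {+ (p ^ k)} (divides 0ℤ (+-inverseʳ c)) }

module NewtonLift {p : ℕ} {A B C : ℤ} (s : SimpleRoot p A B C) where
  open SimpleRoot s

  approx : ℕ → ℤ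
  approx zero    = root
  approx (suc k) = approx k - inverse * quadratic A B C (approx k)

  approx-invariant : ∀ k → + (p ^ suc k) ∣ℤ quadratic A B C (approx k) ×
                           + p ∣ℤ inverse * quadratic′ A B (approx k) - + 1
  approx-invariant zero    = subst (_∣ℤ quadratic A B C root) (cong +_ (sym (ℕ.*-identityʳ p))) isRoot ,
                             inverse-derivative
  approx-invariant (suc k) = uncurry (chord-step A B C k (approx k) inverse) (approx-invariant k)

  approx-isRoot : ∀ k → + (p ^ k) ∣ℤ quadratic A B C (approx k)
  approx-isRoot k = ∣-trans (p^n∣p^1+n p k) (proj₁ (approx-invariant k))

  approx-compat : ∀ k → + (p ^ k) ∣ℤ approx (suc k) - approx k
  approx-compat k = subst (_ ∣ℤ_) (sym (step (approx k) inverse _)) (∣n⇒∣m*n {+ (p ^ k)} (- inverse) (approx-isRoot k))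
    where
    step : ∀ u w F → u - w * F - u ≡ (- w) * F
    step = solve-∀

  lift : ℤₚ p
  lift = record { seq = approx ; compat = ∣⇒∣ᵤ ∘ approx-compat }

form : ℤ → ℤ → ℤ → ℤ → ℤ → ℤ → ℤ
form A B T y₁ y₂ y₃ = quadratic A B (quadratic₀ A B y₂ + quadratic₀ A B y₃ - T) y₁

NonsingularZero : ℕ → ℤ → ℤ → ℤ → Set
NonsingularZero p A B T = Σ ℤ λ c₂ → Σ ℤ λ c₃ → SimpleRoot p A B (quadratic₀ A B c₂ + quadratic₀ A B c₃ - T)

-- Modulo A·T the form at (wT, 0, 0) equals T(wB − 1), and its y₁-derivative equals B.
∣A*T⇒nonsingularZero : ∀ {p A B T} w → + p ∣ℤ A * T → + p ∣ℤ w * B - + 1 → NonsingularZero p A B T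
∣A*T⇒nonsingularZero {p} {A} {B} {T} w p∣AT p∣wB-1 =
  0ℤ , 0ℤ , simpleRoot (w * T) w
    (∣ℤ-lincomb (w * w * T) T p∣AT p∣wB-1 (value A B T w))
    (∣ℤ-lincomb (+ 2 * w * w) (+ 1) p∣AT p∣wB-1 (slope A B T w))
  where
  value : ∀ A B T w →
    A * (w * T) * (w * T) + B * (w * T) + ((A * 0ℤ * 0ℤ + B * 0ℤ) + (A * 0ℤ * 0ℤ + B * 0ℤ) - T)
    ≡ w * w * T * (A * T) + T * (w * B - + 1)
  value = solve-∀
  slope : ∀ A B T w → w * (+ 2 * A * (w * T) + B) - + 1 ≡ + 2 * w * w * (A * T) + + 1 * (w * B - + 1)
  slope = solve-∀

module OddPrime (r : ℕ) (p-prime : Prime (suc (r ℕ.* 2))) where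
  p : ℕ
  p = suc (r ℕ.* 2)

  private
    1≤r : 1 ≤ r
    1≤r = ℕ.n≢0⇒n>0 λ { refl → ¬prime[1] p-prime }

    r*2≡r+r : r ℕ.* 2 ≡ r ℕ.+ r
    r*2≡r+r = trans (ℕ.*-comm r 2) (cong (r ℕ.+_) (ℕ.+-identityʳ r))

    r+r<p : r ℕ.+ r < p
    r+r<p = ℕ.s≤s (ℕ.≤-reflexive (sym r*2≡r+r))

    r<p : r < p
    r<p = ℕ.≤-<-trans (ℕ.m≤m+n r r) r+r<p

  p∤2 : ¬ + p ∣ℤ + 2
  p∤2 p∣2 with ∣ℤ-small⇒≡0 p∣2 (ℕ.s≤s (ℕ.*-monoˡ-≤ 2 1≤r))
  ... | ()

  squares-injective : ∀ {a b} → a ≤ r → b ≤ r → + p ∣ℤ + a * + a - + b * + b → a ≡ b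
  squares-injective {a} {b} a≤r b≤r p∣a²-b²
    with prime-∣ℤ-* p-prime (+ a + + b) (+ a - + b) (subst (_ ∣ℤ_) (difference-of-squares (+ a) (+ b)) p∣a²-b²)
  ... | inj₁ p∣a+b = trans (ℕ.m+n≡0⇒m≡0 a a+b≡0) (sym (ℕ.m+n≡0⇒n≡0 a a+b≡0))
    where
    a+b≡0 : a ℕ.+ b ≡ 0
    a+b≡0 = +-injective (∣ℤ-small⇒≡0 (subst (+ p ∣ℤ_) (sym (pos-+ a b)) p∣a+b)
                                     (ℕ.≤-<-trans (ℕ.+-mono-≤ a≤r b≤r) r+r<p))
  ... | inj₂ p∣a-b = +-injective (i-j≡0⇒i≡j (+ a) (+ b) (∣ℤ-small⇒≡0 p∣a-b ∣a-b∣<p))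
    where
    ∣a-b∣<p : ∣ + a - + b ∣ < p
    ∣a-b∣<p = ℕ.≤-<-trans (subst (ℕ._≤ a ⊔ b) (cong ∣_∣ (sym (m-n≡m⊖n a b))) (∣m⊝n∣≤m⊔n a b))
                          (ℕ.≤-<-trans (ℕ.⊔-lub a≤r b≤r) r<p)

  private
    square : Fin (suc r) → ℤ
    square a = + toℕ a * + toℕ a

    toℕ≤r : (a : Fin (suc r)) → toℕ a ≤ r
    toℕ≤r a = ℕ.≤-pred (toℕ<n a)

    candidate : ℤ → Fin (suc r) ⊎ Fin (suc r) → ℤ
    candidate N = [ square , (λ b → N - square b) ]′

    residue : ℤ → Fin p
    residue x = fromℕ< (n%ℕd<d x p)

    residue-≡⇒∣ℤ : ∀ {x y} → residue x ≡ residue y → + p ∣ℤ x - y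
    residue-≡⇒∣ℤ {x} {y} eq = %ℕ-≡⇒∣ℤ- p x y
      (trans (sym (toℕ-fromℕ< _)) (trans (cong toℕ eq) (toℕ-fromℕ< _)))

    squares-collide : ∀ N u v → u ≢ v → + p ∣ℤ candidate N u - candidate N v →
                      ∃₂ λ a b → + p ∣ℤ a * a + b * b - N
    squares-collide N (inj₁ a) (inj₁ a′) a≢a′ p∣ =
      ⊥-elim (a≢a′ (cong inj₁ (toℕ-injective (squares-injective (toℕ≤r a) (toℕ≤r a′) p∣))))
    squares-collide N (inj₁ a) (inj₂ b) _ p∣ =
      + toℕ a , + toℕ b , subst (_ ∣ℤ_) (identity (+ toℕ a) (+ toℕ b) N) p∣
      where
      identity : ∀ a b N → a * a - (N - b * b) ≡ a * a + b * b - N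
      identity = solve-∀
    squares-collide N (inj₂ b) (inj₁ a) _ p∣ =
      + toℕ a , + toℕ b , subst (_ ∣ℤ_) (identity (+ toℕ a) (+ toℕ b) N) (∣m⇒∣-m p∣)
      where
      identity : ∀ a b N → - ((N - b * b) - a * a) ≡ a * a + b * b - N
      identity = solve-∀
    squares-collide N (inj₂ b) (inj₂ b′) b≢b′ p∣ =
      ⊥-elim (b≢b′ (cong inj₂ (toℕ-injective (squares-injective (toℕ≤r b) (toℕ≤r b′)
        (subst (_ ∣ℤ_) (identity (+ toℕ b) (+ toℕ b′) N) (∣m⇒∣-m p∣))))))
      where
      identity : ∀ b b′ N → - ((N - b * b) - (N - b′ * b′)) ≡ b * b - b′ * b′
      identity = solve-∀

    p<2[1+r] : p < suc r ℕ.+ suc r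
    p<2[1+r] = ℕ.≤-reflexive (cong suc (trans (cong suc r*2≡r+r) (sym (ℕ.+-suc r r))))

  -- Among the p + 1 numbers a² and N − b² (0 ≤ a, b ≤ r) two are congruent mod p, and
  -- distinct squares a² are not, so some a² ≡ N − b².
  sum-of-two-squares-mod : ∀ N → ∃₂ λ a b → + p ∣ℤ a * a + b * b - N
  sum-of-two-squares-mod N with pigeonhole p<2[1+r] (residue ∘ candidate N ∘ splitAt (suc r))
  ... | i , j , i<j , same = squares-collide N _ _ (<⇒≢ i<j ∘ splitAt-injective)
                                (residue-≡⇒∣ℤ {candidate N (splitAt (suc r) i)} same)
    where
    splitAt-injective : splitAt (suc r) i ≡ splitAt (suc r) j → i ≡ j
    splitAt-injective eq = trans (sym (join-splitAt (suc r) (suc r) i))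
                                 (trans (cong (join (suc r) (suc r)) eq) (join-splitAt (suc r) (suc r) j))

  -- Completing the square: 4A·form = Σᵢ (2Ayᵢ + B)² − (4AT + 3B²). Prescribe 2Ayᵢ + B ≡ zᵢ
  -- with z₁ = 1, which keeps the y₁-derivative a unit, and z₂² + z₃² ≡ 4AT + 3B² − 1.
  ∤A⇒nonsingularZero : ∀ A B T → ¬ + p ∣ℤ A → NonsingularZero p A B T
  ∤A⇒nonsingularZero A B T p∤A
    with inverse-mod-prime p-prime (+ 2 * A) (prime-∤ℤ-* p-prime p∤2 p∤A)
       | sum-of-two-squares-mod (+ 4 * A * T + + 3 * B * B - + 1)
  ... | W , p∣W2A-1 | z₂ , z₃ , p∣z₂²+z₃²-N =
    y z₂ , y z₃ , simpleRoot (y (+ 1)) (+ 1) isRoot isSimple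
    where
    y : ℤ → ℤ
    y z = W * (z - B)

    p∣D-z : ∀ z → + p ∣ℤ quadratic′ A B (y z) - z
    p∣D-z z = subst (_ ∣ℤ_) (sym (identity A B W z)) (∣n⇒∣m*n (z - B) p∣W2A-1)
      where
      identity : ∀ A B W z → + 2 * A * (W * (z - B)) + B - z ≡ (z - B) * (W * (+ 2 * A) - + 1)
      identity = solve-∀

    p∣D²-z² : ∀ z → + p ∣ℤ quadratic′ A B (y z) * quadratic′ A B (y z) - z * z
    p∣D²-z² z = ∣ℤ-x-y⇒∣ℤ-x²-y² (quadratic′ A B (y z)) z (p∣D-z z)

    p∣4A*form : + p ∣ℤ + 4 * A * form A B T (y (+ 1)) (y z₂) (y z₃)
    p∣4A*form = subst (_ ∣ℤ_) (sym (completing-square A B T (y (+ 1)) (y z₂) (y z₃) z₂ z₃))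
      (∣m∣n⇒∣m+n (∣m∣n⇒∣m+n (∣m∣n⇒∣m+n (p∣D²-z² (+ 1))
                                        (p∣D²-z² z₂))
                             (p∣D²-z² z₃))
                 p∣z₂²+z₃²-N)
      where
      completing-square : ∀ A B T y₁ y₂ y₃ z₂ z₃ →
        + 4 * A * (A * y₁ * y₁ + B * y₁ + ((A * y₂ * y₂ + B * y₂) + (A * y₃ * y₃ + B * y₃) - T))
        ≡ ((+ 2 * A * y₁ + B) * (+ 2 * A * y₁ + B) - + 1 * + 1)
          + ((+ 2 * A * y₂ + B) * (+ 2 * A * y₂ + B) - z₂ * z₂)
          + ((+ 2 * A * y₃ + B) * (+ 2 * A * y₃ + B) - z₃ * z₃)
          + (z₂ * z₂ + z₃ * z₃ - (+ 4 * A * T + + 3 * B * B - + 1))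
      completing-square = solve-∀

    isRoot : + p ∣ℤ form A B T (y (+ 1)) (y z₂) (y z₃)
    isRoot = prime-∣ℤ-*-cancelˡ p-prime (prime-∤ℤ-* p-prime (prime-∤ℤ-* p-prime p∤2 p∤2) p∤A) p∣4A*form

    isSimple : + p ∣ℤ + 1 * quadratic′ A B (y (+ 1)) - + 1
    isSimple = subst (λ D → + p ∣ℤ D - + 1) (sym (*-identityˡ (quadratic′ A B (y (+ 1))))) (p∣D-z (+ 1))

represented : ∀ {p A B T} m n K →
  (∀ y₁ y₂ y₃ → Qterm m y₁ + Qterm m y₂ + Qterm m y₃ - ℓ m n ≡ K * form A B T y₁ y₂ y₃) →
  NonsingularZero p A B T → RepresentedByCoset m p (ℓ m n)
represented {p} m n K reduction (c₂ , c₃ , s) =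
  y , λ k → ∣⇒∣ᵤ (subst (_ ∣ℤ_) (sym (reduction (approx k) c₂ c₃)) (∣n⇒∣m*n K (approx-isRoot k)))
  where
  open NewtonLift s
  y : Fin 3 → ℤₚ p
  y zero             = lift
  y (suc zero)       = fromℤ c₂
  y (suc (suc zero)) = fromℤ c₃

isEven-even : ∀ k → isEven (k ℕ.* 2) ≡ true
isEven-even k = cong (ℕ._≡ᵇ 0) (m*n%n≡0 k 2)

isEven-odd : ∀ h → isEven (suc (h ℕ.* 2)) ≡ false
isEven-odd h = cong (ℕ._≡ᵇ 0) ([m+kn]%n≡m%n 1 h 2)

Qterm-even : ∀ k y → Qterm (k ℕ.* 2) y ≡ sq ((+ k * + 2 - + 2) * y + (+ k - + 2))
Qterm-even k y = begin
  Qterm (k ℕ.* 2) y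
    ≡⟨ if-cong (isEven-even k) ⟩
  sq ((+ (k ℕ.* 2) - + 2) * y + (+ (k ℕ.* 2 / 2) - + 2))
    ≡⟨ cong₂ (λ M K → sq ((M - + 2) * y + (+ K - + 2))) (pos-* k 2) (m*n/n≡m k 2) ⟩
  sq ((+ k * + 2 - + 2) * y + (+ k - + 2))
    ∎
  where open ≡-Reasoning

ℓ-even : ∀ k n → ℓ (k ℕ.* 2) n ≡ + 3 * sq (+ k - + 2) + + 2 * (+ k * + 2 - + 2) * + n
ℓ-even k n = begin
  ℓ (k ℕ.* 2) n
    ≡⟨ if-cong (isEven-even k) ⟩
  + 3 * sq (+ (k ℕ.* 2 / 2) - + 2) + + 2 * (+ (k ℕ.* 2) - + 2) * + n
    ≡⟨ cong₂ (λ M K → + 3 * sq (+ K - + 2) + + 2 * (M - + 2) * + n) (pos-* k 2) (m*n/n≡m k 2) ⟩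
  + 3 * sq (+ k - + 2) + + 2 * (+ k * + 2 - + 2) * + n
    ∎
  where open ≡-Reasoning

Qterm-odd : ∀ h y → let M = + suc (h ℕ.* 2) in Qterm (suc (h ℕ.* 2)) y ≡ sq (+ 2 * (M - + 2) * y + (M - + 4))
Qterm-odd h y = if-cong (isEven-odd h)

ℓ-odd : ∀ h n → let M = + suc (h ℕ.* 2) in ℓ (suc (h ℕ.* 2)) n ≡ + 3 * sq (M - + 4) + + 8 * (M - + 2) * + n
ℓ-odd h n = if-cong (isEven-odd h)

coset-form-even : ∀ k n y₁ y₂ y₃ →
  Qterm (k ℕ.* 2) y₁ + Qterm (k ℕ.* 2) y₂ + Qterm (k ℕ.* 2) y₃ - ℓ (k ℕ.* 2) n
  ≡ + 4 * (+ k - + 1) * form (+ k - + 1) (+ k - + 2) (+ n) y₁ y₂ y₃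
coset-form-even k n y₁ y₂ y₃
  rewrite Qterm-even k y₁ | Qterm-even k y₂ | Qterm-even k y₃ | ℓ-even k n = identity (+ k) (+ n) y₁ y₂ y₃
  where
  identity : ∀ K N y₁ y₂ y₃ →
    ((K * + 2 - + 2) * y₁ + (K - + 2)) * ((K * + 2 - + 2) * y₁ + (K - + 2))
    + ((K * + 2 - + 2) * y₂ + (K - + 2)) * ((K * + 2 - + 2) * y₂ + (K - + 2))
    + ((K * + 2 - + 2) * y₃ + (K - + 2)) * ((K * + 2 - + 2) * y₃ + (K - + 2))
    - (+ 3 * ((K - + 2) * (K - + 2)) + + 2 * (K * + 2 - + 2) * N)
    ≡ + 4 * (K - + 1) * ((K - + 1) * y₁ * y₁ + (K - + 2) * y₁
        + (((K - + 1) * y₂ * y₂ + (K - + 2) * y₂) + ((K - + 1) * y₃ * y₃ + (K - + 2) * y₃) - N))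
  identity = solve-∀

coset-form-odd : ∀ h n y₁ y₂ y₃ → let m = suc (h ℕ.* 2) ; M = + m in
  Qterm m y₁ + Qterm m y₂ + Qterm m y₃ - ℓ m n
  ≡ + 4 * (M - + 2) * form (M - + 2) (M - + 4) (+ 2 * + n) y₁ y₂ y₃
coset-form-odd h n y₁ y₂ y₃
  rewrite Qterm-odd h y₁ | Qterm-odd h y₂ | Qterm-odd h y₃ | ℓ-odd h n = identity (+ suc (h ℕ.* 2)) (+ n) y₁ y₂ y₃
  where
  identity : ∀ M N y₁ y₂ y₃ →
    (+ 2 * (M - + 2) * y₁ + (M - + 4)) * (+ 2 * (M - + 2) * y₁ + (M - + 4))
    + (+ 2 * (M - + 2) * y₂ + (M - + 4)) * (+ 2 * (M - + 2) * y₂ + (M - + 4))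
    + (+ 2 * (M - + 2) * y₃ + (M - + 4)) * (+ 2 * (M - + 2) * y₃ + (M - + 4))
    - (+ 3 * ((M - + 4) * (M - + 4)) + + 8 * (M - + 2) * N)
    ≡ + 4 * (M - + 2) * ((M - + 2) * y₁ * y₁ + (M - + 4) * y₁
        + (((M - + 2) * y₂ * y₂ + (M - + 4) * y₂) + ((M - + 2) * y₃ * y₃ + (M - + 4) * y₃) - + 2 * N))
  identity = solve-∀

nonsingularZero-even : ∀ h n {p} → Prime p →
  let k = suc (h ℕ.* 2) in NonsingularZero p (+ k - + 1) (+ k - + 2) (+ n)
nonsingularZero-even h n {p} p-prime with + p ∣ℤ? + (h ℕ.* 2)
... | yes p∣A = ∣A*T⇒nonsingularZero (- + 1) (∣m⇒∣m*n (+ n) p∣A)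
                  (subst (+ p ∣ℤ_) (identity (+ suc (h ℕ.* 2))) (∣m⇒∣-m p∣A))
  where
  identity : ∀ K → - (K - + 1) ≡ (- + 1) * (K - + 2) - + 1
  identity = solve-∀
... | no p∤A with primeCase p-prime
...   | two            = ⊥-elim (p∤A (divides (+ h) (pos-* h 2)))
...   | odd r p-prime′ = OddPrime.∤A⇒nonsingularZero r p-prime′ _ _ (+ n) p∤A

nonsingularZero-odd : ∀ h n {p} → Prime p →
  let M = + suc (h ℕ.* 2) in NonsingularZero p (M - + 2) (M - + 4) (+ 2 * + n)
nonsingularZero-odd h n {p} p-prime with primeCase p-prime
... | two = ∣A*T⇒nonsingularZero (+ 1) (∣n⇒∣m*n (M - + 2) (∣m⇒∣m*n (+ n) ∣-refl))
              (divides (+ h - + 2) (trans (cong (λ M → + 1 * (M - + 4) - + 1) (+1+2h h)) (identity (+ h))))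
  where
  M = + suc (h ℕ.* 2)
  identity : ∀ h → + 1 * (+ 1 + h * + 2 - + 4) - + 1 ≡ (h - + 2) * + 2
  identity = solve-∀
... | odd r p-prime′ with + p ∣ℤ? + suc (h ℕ.* 2) - + 2
...   | yes p∣A = ∣A*T⇒nonsingularZero (+ r) (∣m⇒∣m*n (+ 2 * + n) p∣A)
                    (∣ℤ-lincomb (+ r) (- + 1) p∣A ∣-refl
                      (trans (identity (+ suc (h ℕ.* 2)) (+ r)) (cong (λ P → + r * (+ suc (h ℕ.* 2) - + 2) + (- + 1) * P) (sym (+1+2h r)))))
  where
  identity : ∀ M r → r * (M - + 4) - + 1 ≡ r * (M - + 2) + (- + 1) * (+ 1 + r * + 2)
  identity = solve-∀
...   | no p∤A = OddPrime.∤A⇒nonsingularZero r p-prime′ _ _ _ p∤A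

represented-even : ∀ h n {p} → Prime p →
  let m = suc (h ℕ.* 2) ℕ.* 2 in RepresentedByCoset m p (ℓ m n)
represented-even h n p-prime =
  represented (k ℕ.* 2) n (+ 4 * (+ k - + 1)) (coset-form-even k n) (nonsingularZero-even h n p-prime)
  where k = suc (h ℕ.* 2)

represented-odd : ∀ h n {p} → Prime p →
  let m = suc (h ℕ.* 2) in RepresentedByCoset m p (ℓ m n)
represented-odd h n p-prime =
  represented m n (+ 4 * (+ m - + 2)) (coset-form-odd h n) (nonsingularZero-odd h n p-prime)
  where m = suc (h ℕ.* 2)

lemma3p3 : (m : ℕ) → 3 ≤ m → ¬ (4 ∣ m) →
    (n p : ℕ) → Prime p → RepresentedByCoset m p (ℓ m n)
lemma3p3 m _ 4∤m n p p-prime with parity m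
... | odd h  = represented-odd h n p-prime
... | even k with parity k
...   | even h = ⊥-elim (4∤m (ℕ.divides h (ℕ.*-assoc h 2 2)))
...   | odd h  = represented-even h n p-prime
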